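{- Every Latin square $L$ of order $n \geq 1$ contains a minimal cover of size $2n-1$. Furthermore, every entry of $L$ belongs to a minimal cover of $L$ of size $2n-1$.
   Context: A Latin square of order $n$ is an $n\times n$ array on $n$ symbols in which each symbol occurs once in each row and each column; its entries are the triples $(i,j,L_{ij})$. A line is the set of all entries in a given row, in a given column, or with a given symbol. A cover is a set of entries meeting every line; a cover $\mathscr{C}$ is minimal if $\mathscr{C}\setminus\{\mathbf{e}\}$ is not a cover for all $\mathbf{e}\in\mathscr{C}$. -}

module Defs where

open import Data.Nat using (ℕ; suc; _+_)
open import Data.Bool using (Bool; true; false; if_then_else_)
open import Data.Fin using (Fin; _≟_)
open import Data.Product using (_×_; ∃; ∃-syntax; _,_)
open import Relation.Binary.PropositionalEquality using (_≡_)
open import Relation.Nullary using (¬_; does)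

record IsLatinSquare (n : ℕ) (L : Fin n → Fin n → Fin n) : Set where
  field
    row-exists : ∀ i s → ∃[ j ] L i j ≡ s
    row-unique : ∀ i j j′ → L i j ≡ L i j′ → j ≡ j′
    col-exists : ∀ j s → ∃[ i ] L i j ≡ s
    col-unique : ∀ j i i′ → L i j ≡ L i′ j → i ≡ i′

-- An entry (i , j , L i j) is determined by its cell (i , j); a set of entries
-- is thus represented by its characteristic function on cells.
EntrySet : ℕ → Set
EntrySet n = Fin n → Fin n → Bool

IsCover : (n : ℕ) → (Fin n → Fin n → Fin n) → EntrySet n → Set
IsCover n L C =
  (∀ i → ∃[ j ] C i j ≡ true) ×
  (∀ j → ∃[ i ] C i j ≡ true) ×
  (∀ s → ∃[ i ] ∃[ j ] (C i j ≡ true × L i j ≡ s))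

remove : {n : ℕ} → EntrySet n → Fin n → Fin n → EntrySet n
remove C a b i j = if does (i ≟ a) then (if does (j ≟ b) then false else C i j) else C i j

IsMinimalCover : (n : ℕ) → (Fin n → Fin n → Fin n) → EntrySet n → Set
IsMinimalCover n L C =
  IsCover n L C × (∀ a b → C a b ≡ true → ¬ IsCover n L (remove C a b))

sumFin : (n : ℕ) → (Fin n → ℕ) → ℕ
sumFin ℕ.zero f = 0
sumFin (suc n) f = f Fin.zero + sumFin n (λ k → f (Fin.suc k))

size : (n : ℕ) → EntrySet n → ℕ
size n C = sumFin n (λ i → sumFin n (λ j → if C i j then 1 else 0))

module Submission where

-- Fix a cell (a , b) and take the "cross" centred at it: every
-- entry lying in row a or in column b.  It has n + (n - 1) = 2n - 1 entries.
-- Row a alone already meets every column and (by the Latin property) every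
-- symbol, and column b meets every row, so the cross is a cover.  It is
-- minimal because every entry of it has a *private line*, a line that it is
-- the only entry of the cross to meet: an entry (a , j) with j ≠ b is alone
-- in column j, an entry (i , b) with i ≠ a is alone in row i, and the centre
-- (a , b) is the only entry of the cross carrying the symbol L a b, since
-- that symbol occurs once in row a and once in column b.

open import Defs
open import Data.Nat using (ℕ; zero; suc; _+_; _*_; _∸_; _≥_)
open import Data.Nat.Properties
  using (+-suc; +-identityʳ; *-zeroʳ; *-identityʳ; +-commutativeSemigroup)
open import Algebra.Properties.CommutativeSemigroup +-commutativeSemigroup
  using (x∙yz≈y∙xz)
open import Data.Bool using (Bool; true; false; _∨_; if_then_else_)
open import Data.Bool.Properties using (∨-zeroʳ)
open import Data.Fin using (Fin; _≟_)
open import Data.Fin.Properties using (suc-injective)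
open import Data.Product using (_×_; ∃-syntax; _,_)
open import Data.Sum using (_⊎_; inj₁; inj₂)
open import Relation.Nullary using (¬_; does; yes; no; contradiction)
open import Relation.Nullary.Decidable using (dec-true; dec-false)
open import Relation.Binary.PropositionalEquality
  using (_≡_; _≢_; refl; sym; trans; cong; module ≡-Reasoning)

sumFin-const : ∀ n (c : ℕ) (f : Fin n → ℕ) → (∀ k → f k ≡ c) → sumFin n f ≡ n * c
sumFin-const zero    c f f≡c = refl
sumFin-const (suc n) c f f≡c rewrite f≡c Fin.zero =
  cong (c +_) (sumFin-const n c (λ k → f (Fin.suc k)) (λ k → f≡c (Fin.suc k)))

sumFin-point : ∀ n (a : Fin n) (m c : ℕ) (f : Fin n → ℕ) →
  f a ≡ m → (∀ k → k ≢ a → f k ≡ c) → sumFin n f ≡ m + (n ∸ 1) * c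
sumFin-point (suc n) Fin.zero m c f fa≡m f≡c rewrite fa≡m =
  cong (m +_) (sumFin-const n c (λ k → f (Fin.suc k)) (λ k → f≡c (Fin.suc k) (λ ())))
sumFin-point (suc (suc n)) (Fin.suc a) m c f fa≡m f≡c = begin
  f Fin.zero + sumFin (suc n) (λ k → f (Fin.suc k)) ≡⟨ cong (_+ _) (f≡c Fin.zero (λ ())) ⟩
  c + sumFin (suc n) (λ k → f (Fin.suc k))          ≡⟨ cong (c +_) tail ⟩
  c + (m + n * c)                                   ≡⟨ x∙yz≈y∙xz c m (n * c) ⟩
  m + (c + n * c)                                   ∎
  where
  open ≡-Reasoning
  tail : sumFin (suc n) (λ k → f (Fin.suc k)) ≡ m + n * c
  tail = sumFin-point (suc n) a m c (λ k → f (Fin.suc k)) fa≡m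
           (λ k k≢a → f≡c (Fin.suc k) (λ e → k≢a (suc-injective e)))

remove-true : ∀ {n} (C : EntrySet n) (a b i j : Fin n) →
  remove C a b i j ≡ true → C i j ≡ true × ¬ (i ≡ a × j ≡ b)
remove-true C a b i j r with i ≟ a | j ≟ b
remove-true C a b i j () | yes _   | yes _
... | yes _   | no j≢b = r , λ (_ , j≡b) → j≢b j≡b
... | no i≢a  | _      = r , λ (i≡a , _) → i≢a i≡a

module _ {n : ℕ} (L : Fin n → Fin n → Fin n) (C : EntrySet n) where

  data PrivateLine (a b : Fin n) : Set where
    private-row : (∀ j → C a j ≡ true → j ≡ b) → PrivateLine a b
    private-col : (∀ i → C i b ≡ true → i ≡ a) → PrivateLine a b
    private-sym : (∀ i j → C i j ≡ true → L i j ≡ L a b → i ≡ a × j ≡ b) →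
                  PrivateLine a b

  private-line-essential : ∀ a b → PrivateLine a b → ¬ IsCover n L (remove C a b)
  private-line-essential a b (private-row alone) (rows , _ , _)
    with rows a
  ... | j , r with remove-true C a b a j r
  ...   | Caj , not-ab = not-ab (refl , alone j Caj)
  private-line-essential a b (private-col alone) (_ , cols , _)
    with cols b
  ... | i , r with remove-true C a b i b r
  ...   | Cib , not-ab = not-ab (alone i Cib , refl)
  private-line-essential a b (private-sym alone) (_ , _ , syms)
    with syms (L a b)
  ... | i , j , r , Lij≡Lab with remove-true C a b i j r
  ...   | Cij , not-ab = not-ab (alone i j Cij Lij≡Lab)

  private-lines⇒minimal : IsCover n L C → (∀ a b → C a b ≡ true → PrivateLine a b) →
    IsMinimalCover n L C
  private-lines⇒minimal cov has-private =
    cov , λ a b Cab → private-line-essential a b (has-private a b Cab)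

cross : ∀ {n} → Fin n → Fin n → EntrySet n
cross a b i j = does (i ≟ a) ∨ does (j ≟ b)

cross-row : ∀ {n} (a b j : Fin n) → cross a b a j ≡ true
cross-row a b j rewrite dec-true (a ≟ a) refl = refl

cross-col : ∀ {n} (a b i : Fin n) → cross a b i b ≡ true
cross-col a b i rewrite dec-true (b ≟ b) refl = ∨-zeroʳ _

cross-outside : ∀ {n} {a b i j : Fin n} → i ≢ a → j ≢ b → cross a b i j ≡ false
cross-outside {a = a} {b} {i} {j} i≢a j≢b
  rewrite dec-false (i ≟ a) i≢a | dec-false (j ≟ b) j≢b = refl

cross-true : ∀ {n} (a b i j : Fin n) → cross a b i j ≡ true → i ≡ a ⊎ j ≡ b
cross-true a b i j c with i ≟ a | j ≟ b
... | yes i≡a | _       = inj₁ i≡a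
... | no _    | yes j≡b = inj₂ j≡b
cross-true a b i j () | no _ | no _

cross-cover : ∀ {n} (L : Fin n → Fin n → Fin n) → IsLatinSquare n L →
  (a b : Fin n) → IsCover n L (cross a b)
cross-cover L latin a b =
  (λ i → b , cross-col a b i) ,
  (λ j → a , cross-row a b j) ,
  (λ s → let (j , Laj≡s) = IsLatinSquare.row-exists latin a s
         in a , j , cross-row a b j , Laj≡s)

-- Every entry of the cross has a private line; only the centre needs the
-- Latin property, to see that its symbol is nowhere else in row a or column b.
cross-private : ∀ {n} (L : Fin n → Fin n → Fin n) → IsLatinSquare n L →
  (a b i j : Fin n) → cross a b i j ≡ true → PrivateLine L (cross a b) i j
cross-private L latin a b i j c with i ≟ a | j ≟ b
... | yes refl | yes refl = private-sym centre-alone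
  where
  centre-alone : ∀ i′ j′ → cross a b i′ j′ ≡ true → L i′ j′ ≡ L a b → i′ ≡ a × j′ ≡ b
  centre-alone i′ j′ c′ same with cross-true a b i′ j′ c′
  ... | inj₁ refl = refl , IsLatinSquare.row-unique latin a j′ b same
  ... | inj₂ refl = IsLatinSquare.col-unique latin b i′ a same , refl
... | yes refl | no j≢b   = private-col alone-in-column
  where
  alone-in-column : ∀ i′ → cross a b i′ j ≡ true → i′ ≡ a
  alone-in-column i′ c′ with cross-true a b i′ j c′
  ... | inj₁ i′≡a = i′≡a
  ... | inj₂ j≡b  = contradiction j≡b j≢b
... | no i≢a   | yes refl = private-row alone-in-row
  where
  alone-in-row : ∀ j′ → cross a b i j′ ≡ true → j′ ≡ b
  alone-in-row j′ c′ with cross-true a b i j′ c′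
  ... | inj₁ i≡a  = contradiction i≡a i≢a
  ... | inj₂ j′≡b = j′≡b
cross-private L latin a b i j () | no _ | no _

count : Bool → ℕ
count x = if x then 1 else 0

-- Row a of the cross is full and every other row contains only its cell in
-- column b, so the cross has n + (n - 1) entries.
cross-size : ∀ {n} (a b : Fin n) → size n (cross a b) ≡ 2 * n ∸ 1
cross-size {suc k} a b = begin
  size (suc k) (cross a b) ≡⟨ sumFin-point (suc k) a (suc k) 1 _ full-row other-row ⟩
  suc k + k * 1            ≡⟨ cong (suc k +_) (*-identityʳ k) ⟩
  suc k + k                ≡⟨ cong (λ m → suc k + m) (sym (+-identityʳ k)) ⟩
  suc (k + (k + 0))        ≡⟨ sym (+-suc k (k + 0)) ⟩
  2 * suc k ∸ 1            ∎
  where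
  open ≡-Reasoning
  full-row : sumFin (suc k) (λ j → count (cross a b a j)) ≡ suc k
  full-row = trans (sumFin-const (suc k) 1 _ (λ j → cong count (cross-row a b j)))
                   (*-identityʳ (suc k))
  other-row : ∀ i → i ≢ a → sumFin (suc k) (λ j → count (cross a b i j)) ≡ 1
  other-row i i≢a =
    trans (sumFin-point (suc k) b 1 0 _ (cong count (cross-col a b i))
                        (λ j j≢b → cong count (cross-outside i≢a j≢b)))
          (cong (1 +_) (*-zeroʳ k))

lemma3p1 : (n : ℕ) → n ≥ 1 → (L : Fin n → Fin n → Fin n) → IsLatinSquare n L →
    (∃[ C ] (IsMinimalCover n L C × size n C ≡ 2 * n ∸ 1)) ×
    (∀ a b → ∃[ C ] (IsMinimalCover n L C × size n C ≡ 2 * n ∸ 1 × C a b ≡ true))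
lemma3p1 (suc k) _ L latin = some-cover , cover-through
  where
  n = suc k
  cover-through : ∀ a b →
    ∃[ C ] (IsMinimalCover n L C × size n C ≡ 2 * n ∸ 1 × C a b ≡ true)
  cover-through a b =
    cross a b ,
    private-lines⇒minimal L (cross a b) (cross-cover L latin a b)
                                        (cross-private L latin a b) ,
    cross-size a b ,
    cross-row a b b
  some-cover : ∃[ C ] (IsMinimalCover n L C × size n C ≡ 2 * n ∸ 1)
  some-cover with cover-through Fin.zero Fin.zero
  ... | C , minimal , size≡ , _ = C , minimal , size≡
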